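{- Let $q$ be a prime number and let $\omega_q=w_0w_1w_2\cdots$ be the generalized Thue-Morse word over $\Sigma_q=\{0,\dots,q-1\}$, $w_i=s_q(i)$. Let $n\ge 1$, $d=q^n-1$, let $x,y$ be non-negative integers with $x+y=q^n-1$, and for a non-negative integer $z$ put $c=c(z)=z\,q^{2n}+y\,q^n+x$. Then \[ \max_{z\ge 0} L_{\omega_q}(c(z),d)=\begin{cases} x+q+1, & n\equiv 0\pmod q,\\ x+1, & \text{otherwise.}\end{cases} \]
   Context: $s_q(i)$ is the sum modulo $q$ of the digits of the base-$q$ expansion of $i$. For $c\ge 0$, $d\ge 1$, $L_{\omega_q}(c,d)$ is the largest $k\ge1$ such that $w_c=w_{c+d}=\cdots=w_{c+(k-1)d}$. -}

module Defs where

open import Data.Nat using (ℕ; zero; suc; _+_; _*_; _<_; _≤_; NonZero)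
open import Data.Nat.DivMod using (_/_; _%_)
open import Data.Product using (Σ; _×_)
open import Relation.Binary.PropositionalEquality using (_≡_)
open import Relation.Nullary using (¬_)

-- Sum of the base-q digits of i, computed with fuel (fuel ≥ i suffices for q ≥ 2).
digitSumFuel : (q : ℕ) → .{{_ : NonZero q}} → ℕ → ℕ → ℕ
digitSumFuel q zero    i = 0
digitSumFuel q (suc f) i = i % q + digitSumFuel q f (i / q)

digitSum : (q : ℕ) → .{{_ : NonZero q}} → ℕ → ℕ
digitSum q i = digitSumFuel q i i

s : (q : ℕ) → .{{_ : NonZero q}} → ℕ → ℕ
s q i = digitSum q i % q

w : (q : ℕ) → .{{_ : NonZero q}} → ℕ → ℕ
w q i = s q i

AllEqual : (q : ℕ) → .{{_ : NonZero q}} → (c d k : ℕ) → Set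
AllEqual q c d k = ∀ j → j < k → w q (c + j * d) ≡ w q c

LEq : (q : ℕ) → .{{_ : NonZero q}} → (c d k : ℕ) → Set
LEq q c d k = 1 ≤ k × AllEqual q c d k × (∀ k′ → AllEqual q c d k′ → k′ ≤ k)

MaxLEq : (q : ℕ) → .{{_ : NonZero q}} → (f : ℕ → ℕ) → (d M : ℕ) → Set
MaxLEq q f d M = Σ ℕ (λ z → LEq q (f z) d M) × (∀ z k → AllEqual q (f z) d k → k ≤ M)

module Submission where

-- Let N = q^n, d = N - 1, x + y = d and c(z) = z·N² + y·N + x.  Read in base N, c(z) has
-- the three blocks z | y | x, and adding j·d = j·N - j moves y up and x down by j.  Hence
-- (writing D for the base-q digit sum and K = n(q-1) = D(q^n - 1)):
--   * for j ≤ x the blocks are z | y+j | x-j, which are complements in base N, so D = D z + K;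
--   * for j = x+1 the blocks are z | d | d, so D = D z + 2K;
--   * for j = x+1+(u+1) the blocks are z+1 | u | v with u + 1 + v + 1 = N.
-- If q ∤ K the letter changes at j = x+1, so the maximal run has length x + 1.  If q ∣ K
-- (equivalently q ∣ n, since K ≡ -n mod q) the letter survives up to j = x + q (at z = 0),
-- while for every z the positions x+2 and x+q+1 differ in digit sum by q - 1, so x + q + 1
-- is the maximum.

open import Defs
open import Data.Nat using (ℕ; _+_; _*_; _∸_; _^_; _≤_; NonZero)
open import Data.Nat.DivMod using (_%_)
open import Data.Nat.Primality using (Prime)
open import Data.Product using (_×_)
open import Relation.Binary.PropositionalEquality using (_≡_)
open import Relation.Nullary using (¬_)

open import Data.Nat using (zero; suc; _<_; _/_; z≤n; s≤s; _≤?_; >-nonZero)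
open import Data.Nat.Properties
open import Data.Nat.DivMod
  using (m≡m%n+[m/n]*n; m%n<n; m/n<m; m<n⇒m%n≡m; m<n⇒m/n≡0; m*n/n≡m; m<n*o⇒m/o<n;
         %-remove-+ˡ; %-remove-+ʳ; +-distrib-/-∣ˡ)
open import Data.Nat.Divisibility
  using (_∣_; divides; n∣m*n; ∣m⇒∣m*n; ∣m+n∣m⇒∣n; ∣⇒≤; m%n≡0⇒n∣m; n∣m⇒m%n≡0)
open import Data.Nat.Primality using (¬prime[0]; ¬prime[1])
open import Data.Nat.Tactic.RingSolver using (solve-∀)
open import Data.Product using (_,_)
open import Data.Empty using (⊥-elim)
open import Relation.Nullary using (yes; no)
open import Relation.Binary.PropositionalEquality using (refl; sym; trans; cong; cong₂; subst; subst₂; module ≡-Reasoning)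

open ≡-Reasoning

allEqual-shrink : ∀ {q} .{{_ : NonZero q}} {c d k k′} → k ≤ k′ → AllEqual q c d k′ → AllEqual q c d k
allEqual-shrink k≤k′ run j j<k = run j (<-≤-trans j<k k≤k′)

maxLEq-intro : ∀ {q} .{{_ : NonZero q}} (f : ℕ → ℕ) (d M z₀ : ℕ) → 1 ≤ M →
               AllEqual q (f z₀) d M → (∀ z → ¬ AllEqual q (f z) d (suc M)) → MaxLEq q f d M
maxLEq-intro {q} f d M z₀ 1≤M run noLonger = (z₀ , 1≤M , run , bounded z₀) , bounded
  where
    bounded : ∀ z k → AllEqual q (f z) d k → k ≤ M
    bounded z k run-k with k ≤? M
    ... | yes k≤M = k≤M
    ... | no  k≰M = ⊥-elim (noLonger z (allEqual-shrink {c = f z} {d} (≰⇒> k≰M) run-k))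

same-residue⇒∣ : ∀ {q} .{{_ : NonZero q}} A B → (A + B) % q ≡ A % q → q ∣ B
same-residue⇒∣ {q} A B eq = ∣m+n∣m⇒∣n (divides ((A + B) / q) shifted) (n∣m*n (A / q))
  where
    shifted : A / q * q + B ≡ (A + B) / q * q
    shifted = +-cancelˡ-≡ (A % q) _ _ (begin
      A % q + (A / q * q + B)        ≡⟨ sym (+-assoc (A % q) _ B) ⟩
      A % q + A / q * q + B          ≡⟨ cong (_+ B) (sym (m≡m%n+[m/n]*n A q)) ⟩
      A + B                          ≡⟨ m≡m%n+[m/n]*n (A + B) q ⟩
      (A + B) % q + (A + B) / q * q  ≡⟨ cong (_+ (A + B) / q * q) eq ⟩
      A % q + (A + B) / q * q        ∎)

complement-sum : ∀ {m M} → m < M → m + (M ∸ suc m) + 1 ≡ M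
complement-sum {m} {M} m<M = trans (+-comm (m + (M ∸ suc m)) 1) (m+[n∸m]≡n m<M)

complement<ˡ : ∀ {a b M} → a + b + 1 ≡ M → a < M
complement<ˡ {a} {b} refl = ≤-trans (s≤s (m≤m+n a b)) (≤-reflexive (+-comm 1 (a + b)))

complement<ʳ : ∀ {a b M} → a + b + 1 ≡ M → b < M
complement<ʳ {a} {b} eq = complement<ˡ (trans (cong (_+ 1) (+-comm b a)) eq)

complement-digits : ∀ {u u′ v v′ M Q} → u + u′ + 1 ≡ M → v + v′ + 1 ≡ Q →
                    (u * Q + v) + (u′ * Q + v′) + 1 ≡ M * Q
complement-digits {u} {u′} {v} {v′} refl refl = identity u u′ v v′
  where
    identity : ∀ u u′ v v′ → (u * (v + v′ + 1) + v) + (u′ * (v + v′ + 1) + v′) + 1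
                             ≡ (u + u′ + 1) * (v + v′ + 1)
    identity = solve-∀

base<power : ∀ q′ {n} → 2 ≤ n → suc (suc q′) < suc (suc q′) ^ n
base<power q′ 2≤n = <-≤-trans q<q² (^-monoʳ-≤ q 2≤n)
  where
    q : ℕ
    q = suc (suc q′)
    q<q² : q < q ^ 2
    q<q² = subst₂ _<_ (*-identityʳ q) (cong (q *_) (sym (*-identityʳ q))) (*-monoʳ-< q (s≤s (s≤s z≤n)))

module Digits (q′ : ℕ) where

  q : ℕ
  q = suc (suc q′)

  D : ℕ → ℕ
  D = digitSum q

  digitSumFuel-zero : ∀ f → digitSumFuel q f 0 ≡ 0
  digitSumFuel-zero zero    = refl
  digitSumFuel-zero (suc f) = digitSumFuel-zero f

  fuel-irrelevant : ∀ f g i → i ≤ f → i ≤ g → digitSumFuel q f i ≡ digitSumFuel q g i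
  fuel-irrelevant zero    g       zero    _ _ = sym (digitSumFuel-zero g)
  fuel-irrelevant (suc f) zero    zero    _ _ = digitSumFuel-zero (suc f)
  fuel-irrelevant (suc f) (suc g) zero    _ _ = cong (0 % q +_) (fuel-irrelevant f g 0 z≤n z≤n)
  fuel-irrelevant (suc f) (suc g) (suc i) (s≤s i≤f) (s≤s i≤g) =
    cong (suc i % q +_) (fuel-irrelevant f g (suc i / q) (≤-trans shrinks i≤f) (≤-trans shrinks i≤g))
    where
      shrinks : suc i / q ≤ i
      shrinks = ≤-pred (m/n<m (suc i) q (s≤s (s≤s z≤n)))

  digitSum-unfold : ∀ i → D i ≡ i % q + D (i / q)
  digitSum-unfold zero    = refl
  digitSum-unfold (suc i) = cong (suc i % q +_)
    (fuel-irrelevant i (suc i / q) (suc i / q) (≤-pred (m/n<m (suc i) q (s≤s (s≤s z≤n)))) ≤-refl)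

  digitSum-digit : ∀ a r → r < q → D (a * q + r) ≡ r + D a
  digitSum-digit a r r<q = begin
      D (a * q + r)                          ≡⟨ digitSum-unfold (a * q + r) ⟩
      (a * q + r) % q + D ((a * q + r) / q)  ≡⟨ cong₂ (λ u v → u + D v) lastDigit leadingDigits ⟩
      r + D a                                ∎
    where
      lastDigit : (a * q + r) % q ≡ r
      lastDigit = trans (%-remove-+ˡ r (n∣m*n a)) (m<n⇒m%n≡m r<q)
      leadingDigits : (a * q + r) / q ≡ a
      leadingDigits = begin
        (a * q + r) / q    ≡⟨ +-distrib-/-∣ˡ r (n∣m*n a) ⟩
        a * q / q + r / q  ≡⟨ cong₂ _+_ (m*n/n≡m a q) (m<n⇒m/n≡0 r<q) ⟩
        a + 0              ≡⟨ +-identityʳ a ⟩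
        a                  ∎

  digitSum-small : ∀ r → r < q → D r ≡ r
  digitSum-small r r<q = trans (digitSum-digit 0 r r<q) (+-identityʳ r)

  digitSum-base : D q ≡ 1
  digitSum-base = trans (cong D (sym (trans (+-identityʳ (1 * q)) (*-identityˡ q)))) (digitSum-digit 1 0 (s≤s z≤n))

  digitSum-concat : ∀ k a b → b < q ^ k → D (a * q ^ k + b) ≡ D a + D b
  digitSum-concat zero    a zero    _ = trans (cong D (trans (+-identityʳ _) (*-identityʳ a))) (sym (+-identityʳ (D a)))
  digitSum-concat zero    a (suc b) (s≤s ())
  digitSum-concat (suc k) a b b<qᵏ⁺¹ = begin
      D (a * q ^ suc k + b)                ≡⟨ cong D split ⟩
      D ((a * q ^ k + b / q) * q + b % q)  ≡⟨ digitSum-digit (a * q ^ k + b / q) (b % q) (m%n<n b q) ⟩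
      b % q + D (a * q ^ k + b / q)        ≡⟨ cong (b % q +_) (digitSum-concat k a (b / q) high<) ⟩
      b % q + (D a + D (b / q))            ≡⟨ swap (b % q) (D a) (D (b / q)) ⟩
      D a + (b % q + D (b / q))            ≡⟨ cong (D a +_) (sym (digitSum-unfold b)) ⟩
      D a + D b                            ∎
    where
      swap : ∀ r s t → r + (s + t) ≡ s + (r + t)
      swap = solve-∀
      high< : b / q < q ^ k
      high< = m<n*o⇒m/o<n (subst (b <_) (*-comm q (q ^ k)) b<qᵏ⁺¹)
      shift : ∀ a P r m Q → a * (Q * P) + (r + m * Q) ≡ (a * P + m) * Q + r
      shift = solve-∀
      split : a * q ^ suc k + b ≡ (a * q ^ k + b / q) * q + b % q
      split = trans (cong (a * q ^ suc k +_) (m≡m%n+[m/n]*n b q)) (shift a (q ^ k) (b % q) (b / q) q)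

  -- k(q - 1), the digit sum of q^k - 1 (all k digits maximal).
  fullDigitSum : ℕ → ℕ
  fullDigitSum k = k * suc q′

  -- Complements: if a + b = q^k - 1 then no carries occur and every digit pair sums to
  -- q - 1, so D a + D b = k(q - 1).
  digitSum-complement : ∀ k a b → a + b + 1 ≡ q ^ k → D a + D b ≡ fullDigitSum k
  digitSum-complement zero a b eq with m+n≡0⇒m≡0 a sum≡0 | m+n≡0⇒n≡0 a sum≡0
    where
      sum≡0 : a + b ≡ 0
      sum≡0 = +-cancelʳ-≡ 1 (a + b) 0 eq
  ... | refl | refl = refl
  digitSum-complement (suc k) a b eq = begin
      D a + D b                          ≡⟨ cong₂ _+_ (cong D a-split) (cong D b-split) ⟩
      D (a₁ * q + a₀) + D (b₁ * q + b₀)  ≡⟨ cong₂ _+_ (digitSum-digit a₁ a₀ a₀<q) (digitSum-digit b₁ b₀ b₀<q) ⟩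
      (a₀ + D a₁) + (b₀ + D b₁)          ≡⟨ exchange a₀ (D a₁) b₀ (D b₁) ⟩
      (a₀ + b₀) + (D a₁ + D b₁)          ≡⟨ cong₂ _+_ low-digits (digitSum-complement k a₁ b₁ high-complement) ⟩
      suc q′ + fullDigitSum k            ∎
    where
      exchange : ∀ r s t u → (r + s) + (t + u) ≡ (r + t) + (s + u)
      exchange = solve-∀
      a₀ a₁ b₀ b₁ : ℕ
      a₀ = a % q
      a₁ = a / q
      b₀ = q ∸ suc a₀
      b₁ = q ^ k ∸ suc a₁
      a₀<q : a₀ < q
      a₀<q = m%n<n a q
      b₀<q : b₀ < q
      b₀<q = s≤s (m∸n≤m (suc q′) a₀)
      a₁<qᵏ : a₁ < q ^ k
      a₁<qᵏ = m<n*o⇒m/o<n (subst (a <_) (*-comm q (q ^ k)) (complement<ˡ eq))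
      low-complement : a₀ + b₀ + 1 ≡ q
      low-complement = complement-sum a₀<q
      high-complement : a₁ + b₁ + 1 ≡ q ^ k
      high-complement = complement-sum a₁<qᵏ
      low-digits : a₀ + b₀ ≡ suc q′
      low-digits = suc-injective (trans (+-comm 1 (a₀ + b₀)) low-complement)
      a-split : a ≡ a₁ * q + a₀
      a-split = trans (m≡m%n+[m/n]*n a q) (+-comm a₀ (a₁ * q))
      b-split : b ≡ b₁ * q + b₀
      b-split = +-cancelˡ-≡ a _ _ (+-cancelʳ-≡ 1 (a + b) _ (begin
        a + b + 1                          ≡⟨ eq ⟩
        q ^ suc k                          ≡⟨ *-comm q (q ^ k) ⟩
        q ^ k * q                          ≡⟨ sym (complement-digits {a₁} {b₁} {a₀} {b₀} high-complement low-complement) ⟩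
        (a₁ * q + a₀) + (b₁ * q + b₀) + 1  ≡⟨ cong (λ t → t + (b₁ * q + b₀) + 1) (sym a-split) ⟩
        a + (b₁ * q + b₀) + 1              ∎))

  -- K = n(q - 1) ≡ -n (mod q): if q divides the full digit sum then q divides k.
  ∣fullDigitSum⇒∣ : ∀ k → q ∣ fullDigitSum k → q ∣ k
  ∣fullDigitSum⇒∣ k q∣K = ∣m+n∣m⇒∣n (subst (q ∣_) multiple (n∣m*n k)) q∣K
    where
      multiple : k * q ≡ fullDigitSum k + k
      multiple = trans (*-suc k (suc q′)) (+-comm k (fullDigitSum k))

module Progression (q′ n d : ℕ) (qⁿ≡1+d : suc (suc q′) ^ n ≡ suc d) (x y : ℕ) (x+y≡d : x + y ≡ d) where
  open Digits q′

  N : ℕ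
  N = suc d

  c : ℕ → ℕ
  c z = z * (N * N) + y * N + x

  K : ℕ
  K = fullDigitSum n

  complement : ∀ a b → a + b + 1 ≡ N → D a + D b ≡ K
  complement a b eq = digitSum-complement n a b (trans eq (sym qⁿ≡1+d))

  concat : ∀ a b → b < N → D (a * N + b) ≡ D a + D b
  concat a b = subst (λ M → b < M → D (a * M + b) ≡ D a + D b) qⁿ≡1+d (digitSum-concat n a b)

  -- d = N - 1 has all digits maximal.
  digitSum-d : D d ≡ K
  digitSum-d = trans (sym (+-identityʳ (D d))) (complement d 0 (trans (cong (_+ 1) (+-identityʳ d)) (+-comm d 1)))

  position-before : ∀ z j r → j + r ≡ x → c z + j * d ≡ (z * N + (y + j)) * N + r
  position-before z j r j+r≡x =
    subst (λ t → z * (N * N) + y * N + t + j * d ≡ (z * N + (y + j)) * N + r) j+r≡x (identity z y j r d)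
    where
      identity : ∀ z y j r d → z * (suc d * suc d) + y * suc d + (j + r) + j * d
                               ≡ (z * suc d + (y + j)) * suc d + r
      identity = solve-∀

  position-at : ∀ z → c z + suc x * d ≡ (z * N + d) * N + d
  position-at z = begin
      c z + suc x * d               ≡⟨ identity z x y d ⟩
      (z * N + (x + y)) * N + d     ≡⟨ cong (λ t → (z * N + t) * N + d) x+y≡d ⟩
      (z * N + d) * N + d           ∎
    where
      identity : ∀ z x y d → z * (suc d * suc d) + y * suc d + x + suc x * d
                             ≡ (z * suc d + (x + y)) * suc d + d
      identity = solve-∀

  position-after : ∀ z u v → suc u + v + 1 ≡ N → c z + (suc x + suc u) * d ≡ (suc z * N + u) * N + v
  position-after z u v blocks = begin
      c z + (suc x + suc u) * d          ≡⟨ distribute (c z) x u d ⟩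
      c z + suc x * d + suc u * d        ≡⟨ cong (_+ suc u * d) (position-at z) ⟩
      (z * N + d) * N + d + suc u * d    ≡⟨ subst (λ t → (z * suc t + t) * suc t + t + suc u * t
                                                     ≡ (suc z * suc t + u) * suc t + v) d≡1+u+v (carry z u v) ⟩
      (suc z * N + u) * N + v            ∎
    where
      distribute : ∀ C x u d → C + (suc x + suc u) * d ≡ C + suc x * d + suc u * d
      distribute = solve-∀
      carry : ∀ z u v → (z * suc (suc (u + v)) + suc (u + v)) * suc (suc (u + v)) + suc (u + v) + suc u * suc (u + v)
                        ≡ (suc z * suc (suc (u + v)) + u) * suc (suc (u + v)) + v
      carry = solve-∀
      d≡1+u+v : suc (u + v) ≡ d
      d≡1+u+v = suc-injective (trans (+-comm 1 (suc u + v)) blocks)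

  digitSum-before : ∀ z j → j ≤ x → D (c z + j * d) ≡ D z + K
  digitSum-before z j j≤x = begin
      D (c z + j * d)                ≡⟨ cong D (position-before z j r j+r≡x) ⟩
      D ((z * N + (y + j)) * N + r)  ≡⟨ concat (z * N + (y + j)) r (complement<ʳ blocks) ⟩
      D (z * N + (y + j)) + D r      ≡⟨ cong (_+ D r) (concat z (y + j) (complement<ˡ blocks)) ⟩
      D z + D (y + j) + D r          ≡⟨ +-assoc (D z) (D (y + j)) (D r) ⟩
      D z + (D (y + j) + D r)        ≡⟨ cong (D z +_) (complement (y + j) r blocks) ⟩
      D z + K                        ∎
    where
      r : ℕ
      r = x ∸ j
      j+r≡x : j + r ≡ x
      j+r≡x = m+[n∸m]≡n j≤x
      blocks : y + j + r + 1 ≡ N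
      blocks = begin
        y + j + r + 1    ≡⟨ cong (_+ 1) (+-assoc y j r) ⟩
        y + (j + r) + 1  ≡⟨ cong (λ t → y + t + 1) j+r≡x ⟩
        y + x + 1        ≡⟨ cong (_+ 1) (trans (+-comm y x) x+y≡d) ⟩
        d + 1            ≡⟨ +-comm d 1 ⟩
        N                ∎

  digitSum-start : ∀ z → D (c z) ≡ D z + K
  digitSum-start z = trans (cong D (sym (+-identityʳ (c z)))) (digitSum-before z 0 z≤n)

  -- Position x + 1: a second complementary pair appears, adding K.
  digitSum-at : ∀ z → D (c z + suc x * d) ≡ D z + K + K
  digitSum-at z = begin
      D (c z + suc x * d)      ≡⟨ cong D (position-at z) ⟩
      D ((z * N + d) * N + d)  ≡⟨ concat (z * N + d) d (n<1+n d) ⟩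
      D (z * N + d) + D d      ≡⟨ cong (_+ D d) (concat z d (n<1+n d)) ⟩
      D z + D d + D d          ≡⟨ cong₂ (λ s t → D z + s + t) digitSum-d digitSum-d ⟩
      D z + K + K              ∎

  -- Positions x + 1 + (u + 1): the blocks are z + 1 | u | v with v the complement of u + 1,
  -- so D = D (z + 1) + D u + (K - D (u + 1)); stated additively to avoid truncated subtraction.
  digitSum-after : ∀ z u → suc u < N → D (c z + (suc x + suc u) * d) + D (suc u) ≡ D (suc z) + D u + K
  digitSum-after z u 1+u<N = begin
      D (c z + (suc x + suc u) * d) + D (suc u)  ≡⟨ cong (λ t → D t + D (suc u)) (position-after z u v blocks) ⟩
      D ((suc z * N + u) * N + v) + D (suc u)    ≡⟨ cong (_+ D (suc u)) (concat (suc z * N + u) v (complement<ʳ {suc u} blocks)) ⟩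
      D (suc z * N + u) + D v + D (suc u)        ≡⟨ cong (λ t → t + D v + D (suc u)) (concat (suc z) u u<N) ⟩
      D (suc z) + D u + D v + D (suc u)          ≡⟨ +-assoc (D (suc z) + D u) (D v) (D (suc u)) ⟩
      D (suc z) + D u + (D v + D (suc u))        ≡⟨ cong (D (suc z) + D u +_) (+-comm (D v) (D (suc u))) ⟩
      D (suc z) + D u + (D (suc u) + D v)        ≡⟨ cong (D (suc z) + D u +_) (complement (suc u) v blocks) ⟩
      D (suc z) + D u + K                        ∎
    where
      v : ℕ
      v = N ∸ suc (suc u)
      blocks : suc u + v + 1 ≡ N
      blocks = complement-sum 1+u<N
      u<N : u < N
      u<N = <-trans (n<1+n u) 1+u<N

  run-prefix : ∀ z j → j ≤ x → w q (c z + j * d) ≡ w q (c z)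
  run-prefix z j j≤x = cong (_% q) (trans (digitSum-before z j j≤x) (sym (digitSum-start z)))

  letter-at⇒∣ : ∀ z → w q (c z + suc x * d) ≡ w q (c z) → q ∣ K
  letter-at⇒∣ z eq = same-residue⇒∣ (D z + K) K (begin
      (D z + K + K) % q        ≡⟨ cong (_% q) (sym (digitSum-at z)) ⟩
      D (c z + suc x * d) % q  ≡⟨ eq ⟩
      D (c z) % q              ≡⟨ cong (_% q) (digitSum-start z) ⟩
      (D z + K) % q            ∎)

  ∣⇒letter-at : q ∣ K → ∀ z → w q (c z + suc x * d) ≡ w q (c z)
  ∣⇒letter-at q∣K z = begin
      D (c z + suc x * d) % q  ≡⟨ cong (_% q) (digitSum-at z) ⟩
      (D z + K + K) % q        ≡⟨ %-remove-+ʳ (D z + K) q∣K ⟩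
      (D z + K) % q            ≡⟨ cong (_% q) (sym (digitSum-start z)) ⟩
      D (c z) % q              ∎

  digitSum-after-small : ∀ u → suc u < q → suc u < N → D (c 0 + (suc x + suc u) * d) ≡ D (c 0)
  digitSum-after-small u 1+u<q 1+u<N = +-cancelʳ-≡ (suc u) _ _ (begin
      D (c 0 + (suc x + suc u) * d) + suc u      ≡⟨ cong (D (c 0 + (suc x + suc u) * d) +_) (sym (digitSum-small (suc u) 1+u<q)) ⟩
      D (c 0 + (suc x + suc u) * d) + D (suc u)  ≡⟨ digitSum-after 0 u 1+u<N ⟩
      D 1 + D u + K                              ≡⟨ cong₂ (λ s t → s + t + K) (digitSum-small 1 (s≤s (s≤s z≤n)))
                                                                           (digitSum-small u (<-trans (n<1+n u) 1+u<q)) ⟩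
      suc u + K                                  ≡⟨ +-comm (suc u) K ⟩
      K + suc u                                  ≡⟨ cong (_+ suc u) (sym (digitSum-start 0)) ⟩
      D (c 0) + suc u                            ∎)

  digitSum-gap : q < N → ∀ z → D (c z + (suc x + q) * d) ≡ D (c z + (suc x + 1) * d) + suc q′
  digitSum-gap q<N z = +-cancelʳ-≡ 1 _ _ (begin
      D far + 1                        ≡⟨ cong (D far +_) (sym digitSum-base) ⟩
      D far + D q                      ≡⟨ digitSum-after z (suc q′) q<N ⟩
      D (suc z) + D (suc q′) + K       ≡⟨ cong (λ t → D (suc z) + t + K) (digitSum-small (suc q′) ≤-refl) ⟩
      D (suc z) + suc q′ + K           ≡⟨ rearrange (D (suc z)) (suc q′) K ⟩
      D (suc z) + 0 + K + suc q′       ≡⟨ cong (_+ suc q′) (sym (digitSum-after z 0 (<-≤-trans (s≤s (s≤s z≤n)) (<⇒≤ q<N)))) ⟩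
      D near + D 1 + suc q′            ≡⟨ cong (λ t → D near + t + suc q′) (digitSum-small 1 (s≤s (s≤s z≤n))) ⟩
      D near + 1 + suc q′              ≡⟨ rearrange (D near) 1 (suc q′) ⟩
      D near + 0 + suc q′ + 1          ≡⟨ cong (λ t → t + suc q′ + 1) (+-identityʳ (D near)) ⟩
      D near + suc q′ + 1              ∎)
    where
      far near : ℕ
      far  = c z + (suc x + q) * d
      near = c z + (suc x + 1) * d
      rearrange : ∀ a b k → a + b + k ≡ a + 0 + k + b
      rearrange = solve-∀

  maxRun-nondivisible : ¬ q ∣ K → MaxLEq q c d (x + 1)
  maxRun-nondivisible q∤K = maxLEq-intro c d (x + 1) 0 (m≤n+m 1 x) run noLonger
    where
      run : AllEqual q (c 0) d (x + 1)
      run j j<x+1 = run-prefix 0 j (≤-pred (subst (j <_) (+-comm x 1) j<x+1))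
      noLonger : ∀ z → ¬ AllEqual q (c z) d (suc (x + 1))
      noLonger z run-z = q∤K (letter-at⇒∣ z (run-z (suc x) (s≤s (≤-reflexive (+-comm 1 x)))))

  maxRun-divisible : q ∣ K → q < N → MaxLEq q c d (x + q + 1)
  maxRun-divisible q∣K q<N = maxLEq-intro c d (x + q + 1) 0 (m≤n+m 1 (x + q)) run noLonger
    where
      length≡ : x + q + 1 ≡ suc x + q
      length≡ = trans (+-assoc x q 1) (trans (cong (x +_) (+-comm q 1)) (+-suc x q))

      Same : ℕ → Set
      Same j = w q (c 0 + j * d) ≡ w q (c 0)

      beyond : ∀ t → t < q → Same (suc x + t)
      beyond zero    _     = subst Same (sym (+-identityʳ (suc x))) (∣⇒letter-at q∣K 0)
      beyond (suc u) 1+u<q = cong (_% q) (digitSum-after-small u 1+u<q (<-trans 1+u<q q<N))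

      run : AllEqual q (c 0) d (x + q + 1)
      run j j<M with j ≤? x
      ... | yes j≤x = run-prefix 0 j j≤x
      ... | no  j≰x = subst Same (m+[n∸m]≡n (≰⇒> j≰x))
                        (beyond (j ∸ suc x) (m<n+o⇒m∸n<o j (suc x) (subst (j <_) length≡ j<M)))

      noLonger : ∀ z → ¬ AllEqual q (c z) d (suc (x + q + 1))
      noLonger z run-z = 1+n≰n (∣⇒≤ q∣q-1)
        where
          last< : suc x + q < suc (x + q + 1)
          last< = s≤s (≤-reflexive (sym length≡))
          q∣q-1 : q ∣ suc q′
          q∣q-1 = same-residue⇒∣ (D (c z + (suc x + 1) * d)) (suc q′) (begin
            (D (c z + (suc x + 1) * d) + suc q′) % q  ≡⟨ cong (_% q) (sym (digitSum-gap q<N z)) ⟩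
            D (c z + (suc x + q) * d) % q             ≡⟨ run-z (suc x + q) last< ⟩
            w q (c z)                                 ≡⟨ sym (run-z (suc x + 1) (≤-<-trans (+-monoʳ-≤ (suc x) (s≤s z≤n)) last<)) ⟩
            D (c z + (suc x + 1) * d) % q             ∎)

lemma2 : (q : ℕ) → .{{_ : NonZero q}} → Prime q →
         (n : ℕ) → 1 ≤ n → (x y : ℕ) → x + y ≡ q ^ n ∸ 1 →
         (n % q ≡ 0 → MaxLEq q (λ z → z * q ^ (2 * n) + y * q ^ n + x) (q ^ n ∸ 1) (x + q + 1))
         × (¬ (n % q ≡ 0) → MaxLEq q (λ z → z * q ^ (2 * n) + y * q ^ n + x) (q ^ n ∸ 1) (x + 1))
lemma2 zero                  p = ⊥-elim (¬prime[0] p)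
lemma2 (suc zero)            p = ⊥-elim (¬prime[1] p)
lemma2 q@(suc (suc q′)) _ n 1≤n x y x+y≡d = divisible , nondivisible
  where
    d : ℕ
    d = q ^ n ∸ 1
    qⁿ≡1+d : q ^ n ≡ suc d
    qⁿ≡1+d = sym (m+[n∸m]≡n (m^n>0 q n))
    open Digits q′ using (∣fullDigitSum⇒∣)
    open Progression q′ n d qⁿ≡1+d x y x+y≡d

    restate : ∀ {M} → MaxLEq q c d M → MaxLEq q (λ z → z * q ^ (2 * n) + y * q ^ n + x) d M
    restate {M} maxRun =
      subst (λ P → MaxLEq q (λ z → z * P + y * q ^ n + x) d M)
            (sym (trans (^-distribˡ-+-* q n (n + 0)) (cong (λ e → q ^ n * q ^ e) (+-identityʳ n))))
            (subst (λ Q → MaxLEq q (λ z → z * (Q * Q) + y * Q + x) d M) (sym qⁿ≡1+d) maxRun)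

    divisible : n % q ≡ 0 → MaxLEq q (λ z → z * q ^ (2 * n) + y * q ^ n + x) d (x + q + 1)
    divisible n%q≡0 = restate (maxRun-divisible (∣m⇒∣m*n (suc q′) q∣n) q<N)
      where
        q∣n : q ∣ n
        q∣n = m%n≡0⇒n∣m n q n%q≡0
        q<N : q < N
        q<N = subst (q <_) qⁿ≡1+d (base<power q′ (≤-trans (s≤s (s≤s z≤n)) (∣⇒≤ {{>-nonZero 1≤n}} q∣n)))

    nondivisible : ¬ (n % q ≡ 0) → MaxLEq q (λ z → z * q ^ (2 * n) + y * q ^ n + x) d (x + 1)
    nondivisible n%q≢0 = restate (maxRun-nondivisible (λ q∣K → n%q≢0 (n∣m⇒m%n≡0 n q (∣fullDigitSum⇒∣ n q∣K))))
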